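{- Let $\mathbf{T}=\{T_c:c\in\Gamma\}$ be a collection of tournaments on a common vertex set, and let $V_1\subseteq V(\mathbf{T})$ and $v\in V(\mathbf{T})\setminus V_1$ with $|V_1|\ge 50$. Let $P=x_1\dots x_{\ell+1}$ be a good oscillating path of length $\ell$ with $2\le\ell\le4$, let $P'=P-x_{\ell+1}$, let $B\subseteq\Gamma$ be a set of $\ell$ colors and $b\in B$. Then $\mathbf{T}[V_1\cup\{v\}]$ contains either a $B$-near-rainbow $(P,2,1)$-broom from $V_1$ to $\{v\}$, or a $(B\setminus\{b\})$-near-rainbow $(P',2,1)$-broom from $V_1$ to $\{v\}$.
   Context: An oriented path is oscillating if each block (maximal consistently oriented subpath) has length at most $2$; it is good if it has length at least $2$ and its last two arcs have opposite orientations. For an oriented path $P=x_1\dots x_k$ ($k\ge2$) and integers $s_1,s_2$, a $(P,s_1,s_2)$-broom is obtained from $P$ by blowing up $x_1$ into $s_1$ vertices (start-tips) and $x_k$ into $s_2$ vertices (end-tips), new arcs keeping the orientation of the corresponding arc of $P$; it is from $X$ to $Y$ if all start-tips are in $X$ and all end-tips in $Y$. A coloring of a broom $F$ is a map $\varphi:E(F)\to\Gamma$ with each arc $e$ in $T_{\varphi(e)}$; it is near-rainbow if all start-tip-arcs share a color, all end-tip-arcs share a color, and every path in $F$ from a start-tip to an end-tip receives distinct colors; $B$-near-rainbow means near-rainbow with all colors in $B$. -}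

module Defs where

open import Data.Nat using (ℕ; zero; suc)
open import Data.Bool using (Bool; true; false; not)
open import Data.Fin using (Fin; zero; suc; inject₁; fromℕ)
open import Data.Fin.Subset using (Subset; _∈_)
open import Data.Vec using (Vec; []; _∷_; lookup)
open import Data.Maybe using (Maybe; just; nothing)
import Data.Maybe as Maybe
open import Data.Sum using (_⊎_; inj₁; inj₂)
open import Data.Product using (_×_)
open import Data.Unit using (⊤)
open import Data.Empty using (⊥)
open import Relation.Nullary using (¬_)
open import Relation.Binary.PropositionalEquality using (_≡_; _≢_)
open import Function.Definitions using (Injective)

-- Tournaments on the vertex set Fin n.  T x y ≡ true means the arc x → y.

IsTournament : ∀ {n} → (Fin n → Fin n → Bool) → Set
IsTournament {n} T =
  (∀ x → T x x ≡ false) × (∀ x y → x ≢ y → T x y ≡ not (T y x))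

-- Oriented paths x₁ … x_{ℓ+1} are given by their orientation vector
-- o : Vec Bool ℓ; o[i] = true means the i-th arc is x_i → x_{i+1},
-- false means x_{i+1} → x_i.

-- every block (maximal consistently oriented subpath) has length ≤ 2,
-- i.e. no three consecutive arcs have the same orientation
Oscillating : ∀ {ℓ} → Vec Bool ℓ → Set
Oscillating (a ∷ b ∷ c ∷ r) = ¬ (a ≡ b × b ≡ c) × Oscillating (b ∷ c ∷ r)
Oscillating _ = ⊤

Good : ∀ {ℓ} → Vec Bool ℓ → Set
Good [] = ⊥
Good (a ∷ []) = ⊥
Good (a ∷ b ∷ []) = ¬ (a ≡ b)
Good (a ∷ b ∷ c ∷ r) = Good (b ∷ c ∷ r)

-- (P,s₁,s₂)-brooms, P with k+1 arcs (so k+2 ≥ 2 vertices x₁ … x_{k+2}).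
-- Vertices: start-tips (Fin s₁), inner vertices x₂ … x_{k+1} (Fin k),
-- end-tips (Fin s₂).

BV : ℕ → ℕ → ℕ → Set
BV s₁ k s₂ = Fin s₁ ⊎ (Fin k ⊎ Fin s₂)

-- position p ∈ {0,…,k} of x₂ … x_{k+2}: inner vertex, or nothing (= last)
innerOrEnd : ∀ k → Fin (suc k) → Maybe (Fin k)
innerOrEnd zero zero = nothing
innerOrEnd (suc k) zero = just zero
innerOrEnd (suc k) (suc p) = Maybe.map suc (innerOrEnd k p)

-- the vertex at position p (0 … k+1) of the copy of P running from
-- start-tip i to end-tip j
sv : ∀ {s₁ k s₂} → Fin s₁ → Fin s₂ → Fin (suc (suc k)) → BV s₁ k s₂
sv i j zero = inj₁ i
sv {k = k} i j (suc p) with innerOrEnd k p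
... | just q = inj₂ (inj₁ q)
... | nothing = inj₂ (inj₂ j)

-- the arc t (0 … k) of the copy of P from start-tip i to end-tip j is the
-- pair (sv i j t , sv i j (t+1)); its orientation is that of arc t of P.
-- The tournament collection T contains this arc in colour c:
ArcIn : ∀ {Γ : Set} {n} → (Γ → Fin n → Fin n → Bool) → Bool → Γ →
        Fin n → Fin n → Set
ArcIn T true  c x y = T c x y ≡ true
ArcIn T false c x y = T c y x ≡ true

arcCol : ∀ {Γ : Set} {s₁ k s₂} → (BV s₁ k s₂ → BV s₁ k s₂ → Γ) →
         Fin s₁ → Fin s₂ → Fin (suc k) → Γ
arcCol φ i j t = φ (sv i j (inject₁ t)) (sv i j (suc t))

-- A C-near-rainbow (P,s₁,s₂)-broom from X to Y in T[W], where C is the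
-- set of allowed colours (a coloring φ assigns a colour to each arc,
-- arcs being identified with ordered pairs of broom vertices).
record NRBroom {Γ : Set} {n : ℕ} (T : Γ → Fin n → Fin n → Bool)
               (W X Y : Subset n) (C : Γ → Set) {k : ℕ}
               (o : Vec Bool (suc k)) (s₁ s₂ : ℕ) : Set where
  field
    emb      : BV s₁ k s₂ → Fin n
    emb-inj  : Injective _≡_ _≡_ emb
    inW      : ∀ x → emb x ∈ W
    startInX : ∀ i → emb (inj₁ i) ∈ X
    endInY   : ∀ j → emb (inj₂ (inj₂ j)) ∈ Y
    φ        : BV s₁ k s₂ → BV s₁ k s₂ → Γ
    arcs     : ∀ i j t → ArcIn T (lookup o t) (arcCol φ i j t)
                           (emb (sv i j (inject₁ t))) (emb (sv i j (suc t)))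
    colsInC  : ∀ i j t → C (arcCol φ i j t)
    startShare : ∀ i i′ j j′ → arcCol φ i j zero ≡ arcCol φ i′ j′ zero
    endShare   : ∀ i i′ j j′ → arcCol φ i j (fromℕ k) ≡ arcCol φ i′ j′ (fromℕ k)
    rainbow  : ∀ i j t t′ → t ≢ t′ → arcCol φ i j t ≢ arcCol φ i j t′

-- Fix a colour d ∈ B ∖ {b}. Since |V₁| ≥ 50, at least 25 vertices of V₁ have
-- their d-arc to v oriented the same way. In a collection of tournaments,
-- any 2^(m+1) vertices carry two paths with m arcs of prescribed orientations
-- and colours that share all vertices but the first: take a vertex of
-- in-degree ≥ 2^m in the tournament of the last arc and recurse into its
-- in-neighbourhood. If the 25 arcs point like the last arc of P, such a pair
-- of paths for P minus its last arc, closed off at v in colour d, is a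
-- B-near-rainbow (P,2,1)-broom. Otherwise they point like the last arc of P′
-- (P is good), and the same construction for P′ uses only colours of B ∖ {b}.
module Submission where

open import Data.Bool using (Bool; true; false; not)
open import Data.Bool.Properties using (T-≡; ¬-not)
open import Data.Fin using (Fin; zero; suc; inject₁; fromℕ; punchIn)
open import Data.Fin.Properties
  using (suc-injective; inject₁-injective; fromℕ≢inject₁; punchIn-injective; punchInᵢ≢i)
open import Data.Fin.Relation.Unary.Top using (View; view; ‵fromℕ; ‵inject₁; view-fromℕ; view-inject₁)
open import Data.Fin.Subset using (Subset; _∈_; _∉_; _∪_; ⁅_⁆; ∣_∣)
open import Data.Fin.Subset.Properties using (p⊆p∪q; q⊆p∪q; x∈⁅x⁆)
open import Data.List using (List; []; _∷_; length; map; filterᵇ)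
open import Data.List.Membership.Propositional using (find) renaming (_∈_ to _∈ˡ_)
open import Data.List.Membership.Propositional.Properties using (∈-filter⁻; ∈-map⁻)
open import Data.List.Properties using (length-map)
open import Data.List.Relation.Unary.All using (All; []; _∷_)
import Data.List.Relation.Unary.All as All
import Data.List.Relation.Unary.All.Properties as Allₚ
open import Data.List.Relation.Unary.Any using (here; there; any?)
open import Data.List.Relation.Unary.Unique.Propositional using (Unique; []; _∷_)
open import Data.List.Relation.Unary.Unique.Propositional.Properties using (filter⁺; map⁺)
open import Data.Maybe using (just; nothing; maybe′)
open import Data.Nat
  using (ℕ; zero; suc; _+_; _*_; _^_; _≤_; z≤n; s≤s; _≤?_; NonZero; >-nonZero; ≤-pred)
open import Data.Nat.ListAction using (sum)
open import Data.Nat.Properties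
  using ( +-suc; +-assoc; +-commutativeSemigroup; +-mono-≤; +-monoˡ-≤; +-cancelˡ-≤; *-suc
        ; *-monoʳ-≤; *-cancelˡ-≤; ^-monoʳ-≤; m^n≢0
        ; ≤-trans; <⇒≤; ≰⇒>; <⇒≱; m≤m+n; m≤n⇒m≤1+n
        ; module ≤-Reasoning)
open import Data.Nat.Solver using (module +-*-Solver)
open import Data.Product using (Σ; ∃; ∃-syntax; _×_; _,_; proj₁; proj₂)
open import Data.Sum using (_⊎_; inj₁; inj₂; [_,_])
import Data.Sum as Sum
open import Data.Vec using (Vec; []; _∷_; lookup; init)
import Data.Vec as Vec
open import Function using (_∘_)
open import Function.Bundles using (Equivalence)
open import Function.Definitions using (Injective)
open import Relation.Binary.PropositionalEquality
  using (_≡_; _≢_; refl; sym; trans; cong; cong₂; subst; subst₂; module ≡-Reasoning)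
open import Relation.Nullary using (yes; no; contradiction)
open import Relation.Nullary.Decidable using (T?)

open import Defs

open +-*-Solver using (solve; _:+_; _:*_; _:=_; con)
open import Algebra.Properties.CommutativeSemigroup +-commutativeSemigroup using (x∙yz≈y∙xz)

private variable
  A : Set
  m : ℕ

_∷ʳ_ : (Fin m → A) → A → Fin (suc m) → A
(f ∷ʳ x) i with view i
... | ‵fromℕ     = x
... | ‵inject₁ j = f j

∷ʳ-fromℕ : (f : Fin m → A) (x : A) → (f ∷ʳ x) (fromℕ m) ≡ x
∷ʳ-fromℕ {m} f x rewrite view-fromℕ m = refl

∷ʳ-inject₁ : (f : Fin m → A) (x : A) (i : Fin m) → (f ∷ʳ x) (inject₁ i) ≡ f i
∷ʳ-inject₁ f x i rewrite view-inject₁ i = refl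

∷ʳ-∀ : {P : A → Set} {f : Fin m → A} {x : A} →
       (∀ i → P (f i)) → P x → ∀ i → P ((f ∷ʳ x) i)
∷ʳ-∀ Pf Px i with view i
... | ‵fromℕ     = Px
... | ‵inject₁ j = Pf j

∷ʳ-injective : {f : Fin m → A} {x : A} →
               Injective _≡_ _≡_ f → (∀ i → f i ≢ x) → Injective _≡_ _≡_ (f ∷ʳ x)
∷ʳ-injective f-inj fresh {i} {j} eq with view i | view j
... | ‵fromℕ     | ‵fromℕ     = refl
... | ‵fromℕ     | ‵inject₁ j = contradiction (sym eq) (fresh j)
... | ‵inject₁ i | ‵fromℕ     = contradiction eq (fresh i)
... | ‵inject₁ i | ‵inject₁ j = cong inject₁ (f-inj eq)

length-filterᵇ-not : (p : A → Bool) (xs : List A) →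
                     length (filterᵇ p xs) + length (filterᵇ (not ∘ p) xs) ≡ length xs
length-filterᵇ-not p []       = refl
length-filterᵇ-not p (x ∷ xs) with p x
... | true  = cong suc (length-filterᵇ-not p xs)
... | false = trans (+-suc _ _) (cong suc (length-filterᵇ-not p xs))

∈-filterᵇ⁻ : (p : A → Bool) {x : A} {xs : List A} → x ∈ˡ filterᵇ p xs → x ∈ˡ xs × p x ≡ true
∈-filterᵇ⁻ p x∈ = let x∈xs , px = ∈-filter⁻ (T? ∘ p) x∈ in x∈xs , Equivalence.to T-≡ px

sum-map-≤ : (f : A → ℕ) {r : ℕ} {xs : List A} →
            All (λ x → f x ≤ r) xs → sum (map f xs) ≤ length xs * r
sum-map-≤ f []       = z≤n
sum-map-≤ f (p ∷ ps) = +-mono-≤ p (sum-map-≤ f ps)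

elements : ∀ {n} → Subset n → List (Fin n)
elements []          = []
elements (true  ∷ p) = zero ∷ map suc (elements p)
elements (false ∷ p) = map suc (elements p)

length-elements : ∀ {n} (p : Subset n) → length (elements p) ≡ ∣ p ∣
length-elements []          = refl
length-elements (true  ∷ p) = cong suc (trans (length-map suc (elements p)) (length-elements p))
length-elements (false ∷ p) = trans (length-map suc (elements p)) (length-elements p)

∈-elements⁻ : ∀ {n} (p : Subset n) {x : Fin n} → x ∈ˡ elements p → x ∈ p
∈-elements⁻ (true  ∷ p) (here refl) = Vec.here
∈-elements⁻ (true  ∷ p) (there x∈) with ∈-map⁻ suc x∈
... | _ , y∈ , refl = Vec.there (∈-elements⁻ p y∈)
∈-elements⁻ (false ∷ p) x∈ with ∈-map⁻ suc x∈
... | _ , y∈ , refl = Vec.there (∈-elements⁻ p y∈)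

elements-unique : ∀ {n} (p : Subset n) → Unique (elements p)
elements-unique []          = []
elements-unique (true  ∷ p) =
  Allₚ.map⁺ (All.universal (λ _ ()) (elements p)) ∷ map⁺ suc-injective (elements-unique p)
elements-unique (false ∷ p) = map⁺ suc-injective (elements-unique p)

r+r≤m+n⇒r≤m⊎r≤n : ∀ r {m n} → r + r ≤ m + n → r ≤ m ⊎ r ≤ n
r+r≤m+n⇒r≤m⊎r≤n r {m} {n} r+r≤m+n with r ≤? m
... | yes r≤m = inj₁ r≤m
... | no  r≰m = inj₂ (+-cancelˡ-≤ r r n (≤-trans r+r≤m+n (+-monoˡ-≤ n (<⇒≤ (≰⇒> r≰m)))))

-- In-degrees in a tournament

arc⇒≢ : ∀ {n} {R : Fin n → Fin n → Bool} → IsTournament R → ∀ {x y} → R x y ≡ true → x ≢ y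
arc⇒≢ (irreflexive , _) {x} Rxx refl with trans (sym Rxx) (irreflexive x)
... | ()

module Indegree {n} (R : Fin n → Fin n → Bool) (R-tournament : IsTournament R) where

  private
    irreflexive : ∀ x → R x x ≡ false
    irreflexive = proj₁ R-tournament
    total : ∀ x y → x ≢ y → R x y ≡ not (R y x)
    total = proj₂ R-tournament

  inNeighbours : List (Fin n) → Fin n → List (Fin n)
  inNeighbours L x = filterᵇ (λ y → R y x) L

  inNeighbours-unique : ∀ {L} x → Unique L → Unique (inNeighbours L x)
  inNeighbours-unique x = filter⁺ (T? ∘ λ y → R y x)

  ∈-inNeighbours⁻ : ∀ {L x y} → y ∈ˡ inNeighbours L x → y ∈ˡ L × R y x ≡ true
  ∈-inNeighbours⁻ = ∈-filterᵇ⁻ _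

  indegree : List (Fin n) → Fin n → ℕ
  indegree L x = length (inNeighbours L x)

  outdegree : List (Fin n) → Fin n → ℕ
  outdegree L x = length (filterᵇ (R x) L)

  indegreeSum : List (Fin n) → ℕ
  indegreeSum L = sum (map (indegree L) L)

  indegree+outdegree : ∀ {x} L → All (x ≢_) L → indegree L x + outdegree L x ≡ length L
  indegree+outdegree     []      []            = refl
  indegree+outdegree {x} (z ∷ L) (x≢z ∷ x∉L) rewrite total x z x≢z with R z x
  ... | true  = cong suc (indegree+outdegree L x∉L)
  ... | false = trans (+-suc _ _) (cong suc (indegree+outdegree L x∉L))

  indegree-self : ∀ x L → indegree (x ∷ L) x ≡ indegree L x
  indegree-self x L rewrite irreflexive x = refl

  sum-indegree-∷ : ∀ x L K →
    sum (map (indegree (x ∷ L)) K) ≡ outdegree K x + sum (map (indegree L) K)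
  sum-indegree-∷ x L []      = refl
  sum-indegree-∷ x L (z ∷ K) with R x z
  ... | true  = cong suc (trans (cong (indegree L z +_) (sum-indegree-∷ x L K))
                                (x∙yz≈y∙xz (indegree L z) (outdegree K x) _))
  ... | false = trans (cong (indegree L z +_) (sum-indegree-∷ x L K))
                      (x∙yz≈y∙xz (indegree L z) (outdegree K x) _)

  indegreeSum-∷ : ∀ {x} L → All (x ≢_) L → indegreeSum (x ∷ L) ≡ length L + indegreeSum L
  indegreeSum-∷ {x} L x∉L = begin
    indegree (x ∷ L) x + sum (map (indegree (x ∷ L)) L)
      ≡⟨ cong₂ _+_ (indegree-self x L) (sum-indegree-∷ x L L) ⟩
    indegree L x + (outdegree L x + indegreeSum L)
      ≡⟨ sym (+-assoc (indegree L x) _ _) ⟩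
    indegree L x + outdegree L x + indegreeSum L
      ≡⟨ cong (_+ indegreeSum L) (indegree+outdegree L x∉L) ⟩
    length L + indegreeSum L ∎
    where open ≡-Reasoning

  indegreeSum-closed-form : ∀ {L} → Unique L → 2 * indegreeSum L + length L ≡ length L * length L
  indegreeSum-closed-form {[]}    []           = refl
  indegreeSum-closed-form {x ∷ L} (x∉L ∷ uniq) = begin
    2 * indegreeSum (x ∷ L) + suc l     ≡⟨ cong (λ s → 2 * s + suc l) (indegreeSum-∷ L x∉L) ⟩
    2 * (l + indegreeSum L) + suc l     ≡⟨ regroup l (indegreeSum L) ⟩
    2 * indegreeSum L + l + (2 * l + 1) ≡⟨ cong (_+ (2 * l + 1)) (indegreeSum-closed-form uniq) ⟩
    l * l + (2 * l + 1)                 ≡⟨ square-suc l ⟩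
    suc l * suc l                       ∎
    where
    open ≡-Reasoning
    l : ℕ
    l = length L
    regroup : ∀ l s → 2 * (l + s) + suc l ≡ 2 * s + l + (2 * l + 1)
    regroup = solve 2 (λ l s → con 2 :* (l :+ s) :+ (con 1 :+ l)
                            := con 2 :* s :+ l :+ (con 2 :* l :+ con 1)) refl
    square-suc : ∀ l → l * l + (2 * l + 1) ≡ suc l * suc l
    square-suc = solve 1 (λ l → l :* l :+ (con 2 :* l :+ con 1) := (con 1 :+ l) :* (con 1 :+ l)) refl

  -- The in-degrees sum to N(N-1)/2, so some in-degree is at least (N-1)/2.
  large-indegree : ∀ {L} → Unique L → ∀ r .{{_ : NonZero r}} → 2 * r ≤ length L →
                   ∃[ x ] x ∈ˡ L × r ≤ indegree L x
  large-indegree {L} uniq (suc r) 2+2r≤N with any? (λ x → suc r ≤? indegree L x) L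
  ... | yes large = find large
  ... | no ¬large = contradiction (subst (_≤ N) (*-suc 2 r) 2+2r≤N) (<⇒≱ (s≤s N≤1+2r))
    where
    N : ℕ
    N = length L
    instance
      N≢0 : NonZero N
      N≢0 = >-nonZero (≤-trans (s≤s z≤n) 2+2r≤N)
    small : All (λ x → indegree L x ≤ r) L
    small = All.map (≤-pred ∘ ≰⇒>) (Allₚ.¬Any⇒All¬ L ¬large)
    N≤1+2r : N ≤ suc (2 * r)
    N≤1+2r = *-cancelˡ-≤ N (begin
      N * N                 ≡⟨ sym (indegreeSum-closed-form uniq) ⟩
      2 * indegreeSum L + N ≤⟨ +-monoˡ-≤ N (*-monoʳ-≤ 2 (sum-map-≤ (indegree L) small)) ⟩
      2 * (N * r) + N       ≡⟨ solve 2 (λ N r → con 2 :* (N :* r) :+ N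
                                            := N :* (con 1 :+ con 2 :* r)) refl N r ⟩
      N * suc (2 * r)       ∎)
      where open ≤-Reasoning

-- Two-tipped paths

-- Two paths with m arcs that differ only in their first vertex. Vertices 0 and
-- 1 are the tips and vertex t + 2 is the head of arc t; position i p is the
-- p-th vertex of the path starting at tip i.

position : Fin 2 → Fin (suc m) → Fin (2 + m)
position i          (suc p) = suc (suc p)
position zero       zero    = zero
position (suc zero) zero    = suc zero

position-inject₁ : ∀ i (p : Fin (suc m)) → position i (inject₁ p) ≡ inject₁ (position i p)
position-inject₁ i          (suc p) = refl
position-inject₁ zero       zero    = refl
position-inject₁ (suc zero) zero    = refl

∷ʳ-position : (f : Fin (2 + m) → A) (x : A) (i : Fin 2) (p : Fin (suc m)) →
              (f ∷ʳ x) (position i (inject₁ p)) ≡ f (position i p)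
∷ʳ-position f x i p = trans (cong (f ∷ʳ x) (position-inject₁ i p)) (∷ʳ-inject₁ f x _)

record TwoTippedPath {n} (m : ℕ) (R : Fin m → Fin n → Fin n → Bool) : Set where
  field
    vertex           : Fin (2 + m) → Fin n
    vertex-injective : Injective _≡_ _≡_ vertex
    arc              : ∀ i t → R t (vertex (position i (inject₁ t))) (vertex (position i (suc t))) ≡ true

open TwoTippedPath

tipPair : ∀ {n} {R : Fin 0 → Fin n → Fin n → Bool} {x y : Fin n} → x ≢ y → TwoTippedPath 0 R
tipPair {n} {x = x} {y} x≢y = record { vertex = tips ; vertex-injective = injective ; arc = λ _ () }
  where
  tips : Fin 2 → Fin n
  tips zero       = x
  tips (suc zero) = y
  injective : Injective _≡_ _≡_ tips
  injective {zero}     {zero}     _ = refl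
  injective {zero}     {suc zero} e = contradiction e x≢y
  injective {suc zero} {zero}     e = contradiction (sym e) x≢y
  injective {suc zero} {suc zero} _ = refl

extend : ∀ {n} {R : Fin (suc m) → Fin n → Fin n → Bool} (P : TwoTippedPath m (R ∘ inject₁)) {x} →
         IsTournament (R (fromℕ m)) → (∀ p → R (fromℕ m) (vertex P p) x ≡ true) →
         TwoTippedPath (suc m) R
extend {m} {R = R} P {x} R-tournament into-x = record
  { vertex           = vertex P ∷ʳ x
  ; vertex-injective = ∷ʳ-injective (vertex-injective P) (arc⇒≢ R-tournament ∘ into-x)
  ; arc              = λ i t → arc′ i (view t)
  }
  where
  arc′ : ∀ i {t} → View t →
         R t ((vertex P ∷ʳ x) (position i (inject₁ t))) ((vertex P ∷ʳ x) (position i (suc t))) ≡ true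
  arc′ i ‵fromℕ       = subst₂ (λ y z → R (fromℕ m) y z ≡ true)
                          (sym (∷ʳ-position (vertex P) x i (fromℕ m))) (sym (∷ʳ-fromℕ (vertex P) x))
                          (into-x _)
  arc′ i (‵inject₁ t) = subst₂ (λ y z → R (inject₁ t) y z ≡ true)
                          (sym (∷ʳ-position (vertex P) x i (inject₁ t)))
                          (sym (∷ʳ-position (vertex P) x i (suc t)))
                          (arc P i t)

twoTippedPathIn : ∀ {n} m (R : Fin m → Fin n → Fin n → Bool) → (∀ t → IsTournament (R t)) →
                  ∀ {L} → Unique L → 2 ^ suc m ≤ length L →
                  Σ (TwoTippedPath m R) λ P → ∀ p → vertex P p ∈ˡ L
twoTippedPathIn zero R _ {x ∷ y ∷ L} ((x≢y ∷ _) ∷ _) _ = tipPair x≢y , in-L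
  where
  in-L : ∀ p → vertex (tipPair {R = R} x≢y) p ∈ˡ x ∷ y ∷ L
  in-L zero       = here refl
  in-L (suc zero) = there (here refl)
twoTippedPathIn zero R _ {_ ∷ []} _ (s≤s ())
twoTippedPathIn {n} (suc m) R tournament {L} uniq 2^[2+m]≤N =
  extend P (tournament (fromℕ m)) (proj₂ ∘ into-x) , ∷ʳ-∀ {P = _∈ˡ L} (proj₁ ∘ into-x) x∈L
  where
  open Indegree (R (fromℕ m)) (tournament (fromℕ m))
  large : ∃[ x ] x ∈ˡ L × 2 ^ suc m ≤ indegree L x
  large = large-indegree uniq (2 ^ suc m) {{m^n≢0 2 (suc m)}} 2^[2+m]≤N
  x : Fin n
  x = proj₁ large
  x∈L : x ∈ˡ L
  x∈L = proj₁ (proj₂ large)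
  P-in-N⁻ : Σ (TwoTippedPath m (R ∘ inject₁)) λ P → ∀ p → vertex P p ∈ˡ inNeighbours L x
  P-in-N⁻ = twoTippedPathIn m (R ∘ inject₁) (tournament ∘ inject₁)
              (inNeighbours-unique x uniq) (proj₂ (proj₂ large))
  P : TwoTippedPath m (R ∘ inject₁)
  P = proj₁ P-in-N⁻
  into-x : ∀ p → vertex P p ∈ˡ L × R (fromℕ m) (vertex P p) x ≡ true
  into-x = ∈-inNeighbours⁻ ∘ proj₂ P-in-N⁻

-- Brooms

innerOrEnd-section : ∀ K (p : Fin (suc K)) → maybe′ inject₁ (fromℕ K) (innerOrEnd K p) ≡ p
innerOrEnd-section zero    zero    = refl
innerOrEnd-section (suc K) zero    = refl
innerOrEnd-section (suc K) (suc p) with innerOrEnd K p | innerOrEnd-section K p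
... | just q  | q≡p = cong suc q≡p
... | nothing | K≡p = cong suc K≡p

innerOrEndIndex : ∀ {K} → Fin K ⊎ Fin 1 → Fin (suc K)
innerOrEndIndex = [ inject₁ , (λ _ → fromℕ _) ]

innerOrEndIndex-injective : ∀ {K} → Injective _≡_ _≡_ (innerOrEndIndex {K})
innerOrEndIndex-injective {x = inj₁ q}    {inj₁ r}    e = cong inj₁ (inject₁-injective e)
innerOrEndIndex-injective {x = inj₁ q}    {inj₂ _}    e = contradiction (sym e) fromℕ≢inject₁
innerOrEndIndex-injective {x = inj₂ _}    {inj₁ r}    e = contradiction e fromℕ≢inject₁
innerOrEndIndex-injective {x = inj₂ zero} {inj₂ zero} _ = refl

broomIndex : ∀ {K} → BV 2 K 1 → Fin (2 + suc K)
broomIndex (inj₁ i) = position i zero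
broomIndex (inj₂ y) = suc (suc (innerOrEndIndex y))

broomIndex-injective : ∀ {K} → Injective _≡_ _≡_ (broomIndex {K})
broomIndex-injective {x = inj₁ zero}       {inj₁ zero}       _ = refl
broomIndex-injective {x = inj₁ (suc zero)} {inj₁ (suc zero)} _ = refl
broomIndex-injective {x = inj₂ y}          {inj₂ y′}         e =
  cong inj₂ (innerOrEndIndex-injective (suc-injective (suc-injective e)))
broomIndex-injective {x = inj₁ zero}       {inj₁ (suc zero)} ()
broomIndex-injective {x = inj₁ (suc zero)} {inj₁ zero}       ()
broomIndex-injective {x = inj₁ zero}       {inj₂ _}          ()
broomIndex-injective {x = inj₁ (suc zero)} {inj₂ _}          ()
broomIndex-injective {x = inj₂ _}          {inj₁ zero}       ()
broomIndex-injective {x = inj₂ _}          {inj₁ (suc zero)} ()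

broomIndex-sv : ∀ {K} i (j : Fin 1) (p : Fin (2 + K)) → broomIndex (sv {k = K} i j p) ≡ position i p
broomIndex-sv     i j zero    = refl
broomIndex-sv {K} i j (suc p) with innerOrEnd K p | innerOrEnd-section K p
... | just q  | q≡p = cong (λ (q : Fin (suc K)) → suc (suc q)) q≡p
... | nothing | K≡p = cong (λ (q : Fin (suc K)) → suc (suc q)) K≡p

module _ {Γ : Set} {n : ℕ} (T : Γ → Fin n → Fin n → Bool) where

  oriented : Bool → Γ → Fin n → Fin n → Bool
  oriented true  c x y = T c x y
  oriented false c x y = T c y x

  oriented⇒ArcIn : ∀ a {c x y} → oriented a c x y ≡ true → ArcIn T a c x y
  oriented⇒ArcIn true  arc = arc
  oriented⇒ArcIn false arc = arc

  oriented-isTournament : (∀ c → IsTournament (T c)) → ∀ a c → IsTournament (oriented a c)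
  oriented-isTournament tournament true  c = tournament c
  oriented-isTournament tournament false c =
    proj₁ (tournament c) , λ x y x≢y → proj₂ (tournament c) y x (x≢y ∘ sym)

  oriented-not : (∀ c → IsTournament (T c)) → ∀ a c {x y} → x ≢ y →
                 oriented (not a) c x y ≡ not (oriented a c x y)
  oriented-not tournament true  c x≢y = proj₂ (tournament c) _ _ (x≢y ∘ sym)
  oriented-not tournament false c x≢y = proj₂ (tournament c) _ _ x≢y

  record Fan (X : Subset n) (v : Fin n) (a : Bool) (c : Γ) (r : ℕ) : Set where
    field
      members        : List (Fin n)
      members-unique : Unique members
      large          : r ≤ length members
      into-v         : ∀ {u} → u ∈ˡ members → u ∈ X × oriented a c u v ≡ true

  majorityFan : (∀ c → IsTournament (T c)) → ∀ {X v} → v ∉ X → ∀ r → r + r ≤ ∣ X ∣ →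
                ∀ a c → Fan X v a c r ⊎ Fan X v (not a) c r
  majorityFan tournament {X} {v} v∉X r r+r≤∣X∣ a c =
    Sum.map (fan towards (λ _ → proj₂)) (fan (not ∘ towards) away)
      (r+r≤m+n⇒r≤m⊎r≤n r (subst (r + r ≤_) (sym split) r+r≤∣X∣))
    where
    towards : Fin n → Bool
    towards u = oriented a c u v
    split : length (filterᵇ towards (elements X)) + length (filterᵇ (not ∘ towards) (elements X))
            ≡ ∣ X ∣
    split = trans (length-filterᵇ-not towards (elements X)) (length-elements X)
    fan : ∀ {a′} p → (∀ u → u ∈ X × p u ≡ true → oriented a′ c u v ≡ true) →
          r ≤ length (filterᵇ p (elements X)) → Fan X v a′ c r
    fan p p⇒a′ r≤ = record
      { members        = filterᵇ p (elements X)
      ; members-unique = filter⁺ (T? ∘ p) (elements-unique X)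
      ; large          = r≤
      ; into-v         = λ u∈ → let u∈L , pu = ∈-filterᵇ⁻ p u∈ ; u∈X = ∈-elements⁻ X u∈L
                                 in u∈X , p⇒a′ _ (u∈X , pu)
      }
    away : ∀ u → u ∈ X × not (towards u) ≡ true → oriented (not a) c u v ≡ true
    away u (u∈X , not-towards) =
      trans (oriented-not tournament a c (λ { refl → v∉X u∈X })) not-towards

  toNRBroom : ∀ {W X Y : Subset n} {C : Γ → Set} {K}
    (o : Vec Bool (suc K)) (col : Fin (suc K) → Γ) → Injective _≡_ _≡_ col → (∀ t → C (col t)) →
    (P : TwoTippedPath (suc K) (λ t → oriented (lookup o t) (col t))) →
    (∀ p → vertex P p ∈ W) → (∀ i → vertex P (position i zero) ∈ X) →
    vertex P (fromℕ (2 + K)) ∈ Y →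
    NRBroom T W X Y C o 2 1
  toNRBroom {C = C} {K} o col col-inj col∈C P in-W tips-in-X end-in-Y = record
    { emb        = vertex P ∘ broomIndex
    ; emb-inj    = broomIndex-injective ∘ vertex-injective P
    ; inW        = in-W ∘ broomIndex
    ; startInX   = tips-in-X
    ; endInY     = λ _ → end-in-Y
    ; φ          = φ
    ; arcs       = arcs
    ; colsInC    = λ i j t → subst C (sym (arcCol≡col i j t)) (col∈C t)
    ; startShare = λ i i′ j j′ → trans (arcCol≡col i j zero) (sym (arcCol≡col i′ j′ zero))
    ; endShare   = λ i i′ j j′ → trans (arcCol≡col i j (fromℕ K)) (sym (arcCol≡col i′ j′ (fromℕ K)))
    ; rainbow    = λ i j t t′ t≢t′ same →
                     t≢t′ (col-inj (trans (sym (arcCol≡col i j t)) (trans same (arcCol≡col i j t′))))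
    }
    where
    -- An arc gets the colour of its head; tips are never heads, so the last clause is junk.
    headColour : Fin (2 + suc K) → Γ
    headColour (suc (suc t)) = col t
    headColour _             = col zero
    φ : BV 2 K 1 → BV 2 K 1 → Γ
    φ _ head = headColour (broomIndex head)
    arcCol≡col : ∀ i j t → arcCol φ i j t ≡ col t
    arcCol≡col i j t = cong headColour (broomIndex-sv i j (suc t))
    arcs : ∀ i j t → ArcIn T (lookup o t) (arcCol φ i j t)
                       (vertex P (broomIndex (sv i j (inject₁ t)))) (vertex P (broomIndex (sv i j (suc t))))
    arcs i j t rewrite arcCol≡col i j t | broomIndex-sv i j (inject₁ t) | broomIndex-sv i j (suc t) =
      oriented⇒ArcIn (lookup o t) (arc P i t)

  nearRainbowBroom : (∀ c → IsTournament (T c)) → ∀ {C : Γ → Set} {K X v r}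
    (o : Vec Bool (suc K)) (col : Fin (suc K) → Γ) → Injective _≡_ _≡_ col → (∀ t → C (col t)) →
    Fan X v (lookup o (fromℕ K)) (col (fromℕ K)) r → 2 ^ suc K ≤ r →
    NRBroom T (X ∪ ⁅ v ⁆) X ⁅ v ⁆ C o 2 1
  nearRainbowBroom tournament {K = K} {X} {v} o col col-inj col∈C F 2^[1+K]≤r =
    toNRBroom o col col-inj col∈C P
      (∷ʳ-∀ {P = _∈ X ∪ ⁅ v ⁆} (p⊆p∪q ⁅ v ⁆ ∘ in-X) (q⊆p∪q X ⁅ v ⁆ (x∈⁅x⁆ v)))
      (λ i → subst (_∈ X) (sym (∷ʳ-position (vertex Q) v i zero)) (in-X (position i zero)))
      (subst (_∈ ⁅ v ⁆) (sym (∷ʳ-fromℕ (vertex Q) v)) (x∈⁅x⁆ v))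
    where
    open Fan F
    R : Fin (suc K) → Fin n → Fin n → Bool
    R t = oriented (lookup o t) (col t)
    R-tournament : ∀ t → IsTournament (R t)
    R-tournament t = oriented-isTournament tournament (lookup o t) (col t)
    Q-in-F : Σ (TwoTippedPath K (R ∘ inject₁)) λ Q → ∀ p → vertex Q p ∈ˡ members
    Q-in-F = twoTippedPathIn K (R ∘ inject₁) (R-tournament ∘ inject₁) members-unique
               (≤-trans 2^[1+K]≤r large)
    Q : TwoTippedPath K (R ∘ inject₁)
    Q = proj₁ Q-in-F
    in-X : ∀ p → vertex Q p ∈ X
    in-X = proj₁ ∘ into-v ∘ proj₂ Q-in-F
    P : TwoTippedPath (suc K) R
    P = extend Q (R-tournament (fromℕ K)) (proj₂ ∘ into-v ∘ proj₂ Q-in-F)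

Good⇒init-last≡not-last : ∀ {k} (o : Vec Bool (2 + k)) → Good o →
                          lookup (init o) (fromℕ k) ≡ not (lookup o (fromℕ (suc k)))
Good⇒init-last≡not-last {zero}  (a ∷ b ∷ [])    a≢b  = ¬-not a≢b
Good⇒init-last≡not-last {suc k} (a ∷ b ∷ c ∷ o) good = Good⇒init-last≡not-last (b ∷ c ∷ o) good

-- Both colourings end with the colour d of the arcs at v.
module Colourings {Γ : Set} {k : ℕ} (B : Fin (2 + k) → Γ) (B-inj : Injective _≡_ _≡_ B)
                  {b : Γ} (i₀ : Fin (2 + k)) (Bi₀≡b : B i₀ ≡ b) where

  i₁ : Fin (2 + k)
  i₁ = punchIn i₀ (fromℕ k)

  d : Γ
  d = B i₁

  all-of-B : Fin (2 + k) → Γ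
  all-of-B = (B ∘ punchIn i₁) ∷ʳ d

  all-of-B-injective : Injective _≡_ _≡_ all-of-B
  all-of-B-injective =
    ∷ʳ-injective (punchIn-injective i₁ _ _ ∘ B-inj) (λ t → punchInᵢ≢i i₁ t ∘ B-inj)

  all-of-B-∈ : ∀ t → ∃ λ i → B i ≡ all-of-B t
  all-of-B-∈ = ∷ʳ-∀ {P = λ c → ∃ λ i → B i ≡ c} (λ t → _ , refl) (_ , refl)

  all-of-B-last : all-of-B (fromℕ (suc k)) ≡ d
  all-of-B-last = ∷ʳ-fromℕ (B ∘ punchIn i₁) d

  B∖b : Fin (suc k) → Γ
  B∖b = B ∘ punchIn i₀

  B∖b-injective : Injective _≡_ _≡_ B∖b
  B∖b-injective = punchIn-injective i₀ _ _ ∘ B-inj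

  B∖b-∈ : ∀ t → ∃ (λ i → B i ≡ B∖b t) × B∖b t ≢ b
  B∖b-∈ t = (_ , refl) , λ B∖b≡b → punchInᵢ≢i i₀ t (B-inj (trans B∖b≡b (sym Bi₀≡b)))

proposition5p10 :
    {Γ : Set} (n : ℕ) (T : Γ → Fin n → Fin n → Bool) →
    (∀ c → IsTournament (T c)) →
    (V₁ : Subset n) (v : Fin n) → v ∉ V₁ → 50 ≤ ∣ V₁ ∣ →
    (k : ℕ) → k ≤ 2 →
    (o : Vec Bool (suc (suc k))) → Oscillating o → Good o →
    (B : Fin (suc (suc k)) → Γ) → Injective _≡_ _≡_ B →
    (b : Γ) → ∃ (λ i → B i ≡ b) →
    NRBroom T (V₁ ∪ ⁅ v ⁆) V₁ ⁅ v ⁆ (λ c → ∃ (λ i → B i ≡ c)) o 2 1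
    ⊎ NRBroom T (V₁ ∪ ⁅ v ⁆) V₁ ⁅ v ⁆ (λ c → ∃ (λ i → B i ≡ c) × c ≢ b) (init o) 2 1
proposition5p10 n T tournament V₁ v v∉V₁ 50≤∣V₁∣ k k≤2 o _ good B B-inj b (i₀ , Bi₀≡b) =
  Sum.map
    (λ F → nearRainbowBroom T tournament o all-of-B all-of-B-injective all-of-B-∈
             (subst (λ c → Fan T V₁ v a c 25) (sym all-of-B-last) F) (2^≤25 (s≤s (s≤s k≤2))))
    (λ F → nearRainbowBroom T tournament (init o) B∖b B∖b-injective B∖b-∈
             (subst (λ a′ → Fan T V₁ v a′ d 25) (sym (Good⇒init-last≡not-last o good)) F)
             (2^≤25 (m≤n⇒m≤1+n (s≤s k≤2))))
    (majorityFan T tournament v∉V₁ 25 50≤∣V₁∣ a d)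
  where
  open Colourings B B-inj i₀ Bi₀≡b
  a : Bool
  a = lookup o (fromℕ (suc k))
  2^≤25 : ∀ {e} → e ≤ 4 → 2 ^ e ≤ 25
  2^≤25 e≤4 = ≤-trans (^-monoʳ-≤ 2 e≤4) (m≤m+n 16 9)
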